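{- Let $G$ be a finite group with $G=\langle x,y\rangle$, where $|x|=4$, $|y|\geq 5$ and $|xy|\geq 3$. Then $\mathrm{Cay}(G,\{x,y\})$ is an oriented regular representation of $G$, unless $|y|=12$, $x=y^9$, and $G\cong\mathbb{Z}_{12}$.
   Context: $|g|$ denotes the order of $g$. A digraph consists of a vertex set and a set of arcs (ordered pairs of vertices); its automorphisms are the vertex permutations preserving the arcs. A digraph is proper if whenever $(u,v)$ is an arc, $(v,u)$ is not. For $S\subseteq G$, the Cayley digraph $\mathrm{Cay}(G,S)$ has vertex set $G$ and $(u,v)$ is an arc whenever $vu^{ -1}\in S$. Its automorphism group contains the right regular representation of $G$; if equality holds it is a digraphical regular representation (DRR), and a DRR which is a proper digraph is an oriented regular representation (ORR). -}

module Defs where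

open import Level using (0ℓ)
open import Data.Nat using (ℕ; zero; suc; _<_; _≤_)
open import Data.Nat.DivMod using (_mod_)
open import Data.Fin using (Fin; toℕ)
open import Data.Fin.Permutation using (Permutation′; _⟨$⟩ʳ_)
open import Data.Product using (Σ; ∃; _×_; _,_)
open import Data.Sum using (_⊎_)
open import Function.Bundles using (_⇔_)
open import Function.Definitions using (Bijective)
open import Relation.Nullary using (¬_)
open import Relation.Binary.PropositionalEquality using (_≡_; _≢_)
open import Algebra.Core using (Op₁; Op₂)
open import Algebra.Structures using (IsGroup)

-- A finite group: carrier Fin n (every finite group is isomorphic to one of these),
-- with propositional equality.
record FinGroup : Set where
  field
    n     : ℕ
    _∙_   : Op₂ (Fin n)
    ε     : Fin n
    _⁻¹   : Op₁ (Fin n)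
    isGroup : IsGroup _≡_ _∙_ ε _⁻¹
  infixl 7 _∙_
  infix 8 _⁻¹

module _ (G : FinGroup) where
  open FinGroup G

  pow : Fin n → ℕ → Fin n
  pow g zero = ε
  pow g (suc k) = g ∙ pow g k

  HasOrder : Fin n → ℕ → Set
  HasOrder g k = (0 < k) × (pow g k ≡ ε) × (∀ j → 0 < j → j < k → pow g j ≢ ε)

  data Generated (x y : Fin n) : Fin n → Set where
    gen-x : Generated x y x
    gen-y : Generated x y y
    gen-ε : Generated x y ε
    gen-∙ : ∀ {a b} → Generated x y a → Generated x y b → Generated x y (a ∙ b)
    gen-⁻¹ : ∀ {a} → Generated x y a → Generated x y (a ⁻¹)

  GeneratedBy : Fin n → Fin n → Set
  GeneratedBy x y = ∀ g → Generated x y g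

  CayArc : (Fin n → Set) → Fin n → Fin n → Set
  CayArc S u v = S (v ∙ u ⁻¹)

  IsCayAut : (Fin n → Set) → Permutation′ n → Set
  IsCayAut S σ = ∀ u v → CayArc S u v ⇔ CayArc S (σ ⟨$⟩ʳ u) (σ ⟨$⟩ʳ v)

  IsDRR : (Fin n → Set) → Set
  IsDRR S = ∀ σ → IsCayAut S σ → ∃ λ g → ∀ u → σ ⟨$⟩ʳ u ≡ u ∙ g

  IsProper : (Fin n → Set) → Set
  IsProper S = ∀ u v → CayArc S u v → ¬ CayArc S v u

  IsORR : (Fin n → Set) → Set
  IsORR S = IsDRR S × IsProper S

  pair : Fin n → Fin n → Fin n → Set
  pair x y g = (g ≡ x) ⊎ (g ≡ y)

  IsoZ12 : Set
  IsoZ12 = Σ (Fin n → Fin 12) λ f →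
    Bijective _≡_ _≡_ f × (∀ a b → f (a ∙ b) ≡ ((toℕ (f a) Data.Nat.+ toℕ (f b)) mod 12))

{-# OPTIONS --safe #-}
-- An automorphism σ of Cay(G,{x,y}) maps the two out-arcs v → xv, v → yv of each vertex onto the
-- two out-arcs of σ v, either keeping or swapping the labels. If it swaps at v, the image of the
-- x-cycle v, xv, x²v, x³v is a closed walk of length 4 beginning with a y-arc; the order
-- conditions rule out every such relation except x y³ = 1 (up to rotation), so x and y commute.
-- Commutation then propagates the swap along the whole x-cycle, which forces y⁴ = 1. Hence σ
-- never swaps, commutes with left multiplication by x and y, and so is a right translation.
-- Properness says s t ≠ 1 for s, t ∈ {x, y}, i.e. |x| ≠ 2, |y| ≠ 2 and |xy| ≠ 1.
module Submission where

open import Defs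
open import Level using (0ℓ)
open import Algebra.Bundles using (Group; Monoid)
open import Algebra.Structures using (IsGroup)
import Algebra.Properties.Group as GroupProperties
open import Tactic.MonoidSolver using (solve)
open import Data.Nat using (_≤_; z<s; _<?_)
open import Data.Nat.Properties using (<-≤-trans)
open import Relation.Nullary.Decidable using (from-yes)
open import Data.Fin using (Fin)
open import Data.Fin.Permutation using (Permutation′; _⟨$⟩ʳ_)
open import Data.Product using (∃; _×_; _,_)
open import Data.Sum using (_⊎_; inj₁; inj₂)
open import Data.Empty using (⊥-elim)
open import Function.Bundles using (Equivalence; Injection)
open import Function.Properties.Inverse using (↔⇒↣)
open import Relation.Nullary using (¬_)
open import Relation.Binary.PropositionalEquality
  using (_≡_; _≢_; refl; sym; trans; cong; cong₂; subst; module ≡-Reasoning)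

group : FinGroup → Group 0ℓ 0ℓ
group G = record { isGroup = FinGroup.isGroup G }

module FinGroupProperties (G : FinGroup) where
  open FinGroup G
  open IsGroup isGroup using (assoc; identityˡ; identityʳ; inverseˡ; inverseʳ)
  open GroupProperties (group G)
    using (∙-cancelˡ; ∙-cancelʳ; inverseʳ-unique; //-rightDividesˡ; //-rightDividesʳ)
  open ≡-Reasoning

  monoid : Monoid 0ℓ 0ℓ
  monoid = Group.monoid (group G)

  pow-two : ∀ g → pow G g 2 ≡ g ∙ g
  pow-two g = cong (g ∙_) (identityʳ g)

  x∙y≡ε⇒y∙x≡ε : ∀ {a b} → a ∙ b ≡ ε → b ∙ a ≡ ε
  x∙y≡ε⇒y∙x≡ε {a} {b} ab≡ε = trans (cong (_∙ a) (inverseʳ-unique a b ab≡ε)) (inverseˡ a)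

  rotate-relator : ∀ {a b c d} → a ∙ (b ∙ (c ∙ d)) ≡ ε → b ∙ (c ∙ (d ∙ a)) ≡ ε
  rotate-relator {a} {b} {c} {d} r = begin
    b ∙ (c ∙ (d ∙ a))   ≡⟨ solve monoid ⟩
    b ∙ (c ∙ d) ∙ a     ≡⟨ x∙y≡ε⇒y∙x≡ε r ⟩
    ε                   ∎

  inverse-commutes : ∀ {a b c} → a ∙ c ≡ ε → c ∙ b ≡ b ∙ c → a ∙ b ≡ b ∙ a
  inverse-commutes {a} {b} {c} ac≡ε cb≡bc = begin
    a ∙ b               ≡⟨ sym (identityʳ _) ⟩
    a ∙ b ∙ ε           ≡⟨ cong (a ∙ b ∙_) (sym (x∙y≡ε⇒y∙x≡ε ac≡ε)) ⟩
    a ∙ b ∙ (c ∙ a)     ≡⟨ solve monoid ⟩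
    a ∙ (b ∙ c) ∙ a     ≡⟨ cong (λ z → a ∙ z ∙ a) (sym cb≡bc) ⟩
    a ∙ (c ∙ b) ∙ a     ≡⟨ solve monoid ⟩
    (a ∙ c) ∙ (b ∙ a)   ≡⟨ cong (_∙ (b ∙ a)) ac≡ε ⟩
    ε ∙ (b ∙ a)         ≡⟨ identityˡ _ ⟩
    b ∙ a               ∎

  module _ {S : Fin n → Set} {σ : Permutation′ n} (aut : IsCayAut G S σ) where

    arc-image : ∀ {s} v → S s → ∃ λ t → S t × σ ⟨$⟩ʳ (s ∙ v) ≡ t ∙ (σ ⟨$⟩ʳ v)
    arc-image {s} v Ss =
      (σ ⟨$⟩ʳ (s ∙ v)) ∙ (σ ⟨$⟩ʳ v) ⁻¹ , image-arc , sym (//-rightDividesˡ _ _)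
      where
      image-arc : CayArc G S (σ ⟨$⟩ʳ v) (σ ⟨$⟩ʳ (s ∙ v))
      image-arc = Equivalence.to (aut v (s ∙ v)) (subst S (sym (//-rightDividesʳ v s)) Ss)

  arc-images-distinct : ∀ (σ : Permutation′ n) {s s′ t v} →
    σ ⟨$⟩ʳ (s ∙ v) ≡ t ∙ (σ ⟨$⟩ʳ v) → σ ⟨$⟩ʳ (s′ ∙ v) ≡ t ∙ (σ ⟨$⟩ʳ v) → s ≡ s′
  arc-images-distinct σ {v = v} e e′ =
    ∙-cancelʳ v _ _ (Injection.injective (↔⇒↣ σ) (trans e (sym e′)))

  no-inverse-pair⇒proper : ∀ {S : Fin n → Set} →
    (∀ {s t} → S s → S t → s ∙ t ≢ ε) → IsProper G S
  no-inverse-pair⇒proper no-pair u v u→v v→u = no-pair u→v v→u (begin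
    (v ∙ u ⁻¹) ∙ (u ∙ v ⁻¹) ≡⟨ solve monoid ⟩
    v ∙ ((u ⁻¹ ∙ u) ∙ v ⁻¹) ≡⟨ cong (λ z → v ∙ (z ∙ v ⁻¹)) (inverseˡ u) ⟩
    v ∙ (ε ∙ v ⁻¹)          ≡⟨ cong (v ∙_) (identityˡ _) ⟩
    v ∙ v ⁻¹                ≡⟨ inverseʳ v ⟩
    ε                       ∎)

  module _ {x y : Fin n} (f : Fin n → Fin n)
           (f-x : ∀ v → f (x ∙ v) ≡ x ∙ f v) (f-y : ∀ v → f (y ∙ v) ≡ y ∙ f v) where

    generated-equivariant : ∀ {h} → Generated G x y h → ∀ v → f (h ∙ v) ≡ h ∙ f v
    generated-equivariant gen-x v = f-x v
    generated-equivariant gen-y v = f-y v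
    generated-equivariant gen-ε v = trans (cong f (identityˡ v)) (sym (identityˡ _))
    generated-equivariant (gen-∙ {a} {b} ga gb) v = begin
      f (a ∙ b ∙ v)     ≡⟨ cong f (assoc _ _ _) ⟩
      f (a ∙ (b ∙ v))   ≡⟨ generated-equivariant ga _ ⟩
      a ∙ f (b ∙ v)     ≡⟨ cong (a ∙_) (generated-equivariant gb v) ⟩
      a ∙ (b ∙ f v)     ≡⟨ sym (assoc _ _ _) ⟩
      a ∙ b ∙ f v       ∎
    generated-equivariant (gen-⁻¹ {a} ga) v = ∙-cancelˡ a _ _ (begin
      a ∙ f (a ⁻¹ ∙ v)      ≡⟨ sym (generated-equivariant ga _) ⟩
      f (a ∙ (a ⁻¹ ∙ v))    ≡⟨ cong f (sym (assoc _ _ _)) ⟩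
      f (a ∙ a ⁻¹ ∙ v)      ≡⟨ cong (λ z → f (z ∙ v)) (inverseʳ a) ⟩
      f (ε ∙ v)             ≡⟨ cong f (identityˡ v) ⟩
      f v                   ≡⟨ sym (identityˡ _) ⟩
      ε ∙ f v               ≡⟨ cong (_∙ f v) (sym (inverseʳ a)) ⟩
      a ∙ a ⁻¹ ∙ f v        ≡⟨ assoc _ _ _ ⟩
      a ∙ (a ⁻¹ ∙ f v)      ∎)

    equivariant⇒right-translation : GeneratedBy G x y → ∀ u → f u ≡ u ∙ f ε
    equivariant⇒right-translation gen u =
      trans (cong f (sym (identityʳ u))) (generated-equivariant (gen u) ε)

module TwoGenerators (G : FinGroup) (x y : Fin (FinGroup.n G))
  (x⁴≡ε : pow G x 4 ≡ FinGroup.ε G)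
  (x²≢ε : pow G x 2 ≢ FinGroup.ε G)
  (y²≢ε : pow G y 2 ≢ FinGroup.ε G)
  (y⁴≢ε : pow G y 4 ≢ FinGroup.ε G)
  (xy≢ε : pow G (FinGroup._∙_ G x y) 1 ≢ FinGroup.ε G)
  (xyxy≢ε : pow G (FinGroup._∙_ G x y) 2 ≢ FinGroup.ε G)
  where
  open FinGroup G
  open IsGroup isGroup using (assoc; identityˡ; identityʳ)
  open GroupProperties (group G) using (∙-cancelˡ; ∙-cancelʳ)
  open FinGroupProperties G
  open ≡-Reasoning

  S : Fin n → Set
  S = pair G x y

  x≢y : x ≢ y
  x≢y refl = y⁴≢ε x⁴≡ε

  x∙x≢y∙y : x ∙ x ≢ y ∙ y
  x∙x≢y∙y xx≡yy = y⁴≢ε (begin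
    pow G y 4               ≡⟨ solve monoid ⟩
    (y ∙ y) ∙ (y ∙ y)       ≡⟨ cong₂ _∙_ (sym xx≡yy) (sym xx≡yy) ⟩
    (x ∙ x) ∙ (x ∙ x)       ≡⟨ solve monoid ⟩
    pow G x 4               ≡⟨ x⁴≡ε ⟩
    ε                       ∎)

  x∙x∙y∙y≢ε : x ∙ (x ∙ (y ∙ y)) ≢ ε
  x∙x∙y∙y≢ε r = x∙x≢y∙y (sym (∙-cancelˡ (x ∙ x) _ _ (begin
    (x ∙ x) ∙ (y ∙ y)   ≡⟨ solve monoid ⟩
    x ∙ (x ∙ (y ∙ y))   ≡⟨ r ⟩
    ε                   ≡⟨ sym x⁴≡ε ⟩
    pow G x 4           ≡⟨ solve monoid ⟩
    (x ∙ x) ∙ (x ∙ x)   ∎)))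

  x∙x∙x∙y≢ε : x ∙ (x ∙ (x ∙ y)) ≢ ε
  x∙x∙x∙y≢ε r = x≢y (sym (∙-cancelˡ (x ∙ (x ∙ x)) _ _ (begin
    x ∙ (x ∙ x) ∙ y     ≡⟨ solve monoid ⟩
    x ∙ (x ∙ (x ∙ y))   ≡⟨ r ⟩
    ε                   ≡⟨ sym x⁴≡ε ⟩
    pow G x 4           ≡⟨ solve monoid ⟩
    x ∙ (x ∙ x) ∙ x     ∎)))

  x∙y³≡ε⇒commute : x ∙ (y ∙ (y ∙ y)) ≡ ε → x ∙ y ≡ y ∙ x
  x∙y³≡ε⇒commute r = inverse-commutes r (solve monoid)

  y∙y≢s∙x : ∀ {s} → S s → y ∙ y ≢ s ∙ x
  y∙y≢s∙x (inj₁ refl) yy≡xx = x∙x≢y∙y (sym yy≡xx)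
  y∙y≢s∙x (inj₂ refl) yy≡yx = x≢y (sym (∙-cancelˡ y _ _ yy≡yx))

  -- Of the relators a b c y, only the rotations of x y³ are compatible with the order conditions.
  closed-walk⇒commute : ∀ {a b c} → S a → S b → S c → a ∙ (b ∙ (c ∙ y)) ≡ ε → x ∙ y ≡ y ∙ x
  closed-walk⇒commute (inj₁ refl) (inj₁ refl) (inj₁ refl) r = ⊥-elim (x∙x∙x∙y≢ε r)
  closed-walk⇒commute (inj₂ refl) (inj₁ refl) (inj₁ refl) r = ⊥-elim (x∙x∙y∙y≢ε (rotate-relator r))
  closed-walk⇒commute (inj₁ refl) (inj₂ refl) (inj₁ refl) r = ⊥-elim (xyxy≢ε (begin
    pow G (x ∙ y) 2     ≡⟨ solve monoid ⟩
    x ∙ (y ∙ (x ∙ y))   ≡⟨ r ⟩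
    ε                   ∎))
  closed-walk⇒commute (inj₂ refl) (inj₂ refl) (inj₂ refl) r = ⊥-elim (y⁴≢ε (begin
    pow G y 4           ≡⟨ solve monoid ⟩
    y ∙ (y ∙ (y ∙ y))   ≡⟨ r ⟩
    ε                   ∎))
  closed-walk⇒commute (inj₁ refl) (inj₁ refl) (inj₂ refl) r = ⊥-elim (x∙x∙y∙y≢ε r)
  closed-walk⇒commute (inj₂ refl) (inj₂ refl) (inj₁ refl) r =
    x∙y³≡ε⇒commute (rotate-relator (rotate-relator r))
  closed-walk⇒commute (inj₂ refl) (inj₁ refl) (inj₂ refl) r = x∙y³≡ε⇒commute (rotate-relator r)
  closed-walk⇒commute (inj₁ refl) (inj₂ refl) (inj₂ refl) r = x∙y³≡ε⇒commute r

  module Automorphism (σ : Permutation′ n) (aut : IsCayAut G S σ) where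
    f : Fin n → Fin n
    f u = σ ⟨$⟩ʳ u

    out-arc-image : ∀ {s} v → S s → ∃ λ t → S t × f (s ∙ v) ≡ t ∙ f v
    out-arc-image = arc-image {S = S} {σ = σ} aut

    Swapped : Fin n → Set
    Swapped v = f (x ∙ v) ≡ y ∙ f v

    x-arc-image : ∀ v → f (x ∙ v) ≡ x ∙ f v ⊎ Swapped v
    x-arc-image v with out-arc-image v (inj₁ refl)
    ... | _ , inj₁ refl , e = inj₁ e
    ... | _ , inj₂ refl , e = inj₂ e

    y-arc-image-unswapped : ∀ {v} → f (x ∙ v) ≡ x ∙ f v → f (y ∙ v) ≡ y ∙ f v
    y-arc-image-unswapped {v} fx with out-arc-image v (inj₂ refl)
    ... | _ , inj₂ refl , e = e
    ... | _ , inj₁ refl , e = ⊥-elim (x≢y (arc-images-distinct σ fx e))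

    y-arc-image-swapped : ∀ {v} → Swapped v → f (y ∙ v) ≡ x ∙ f v
    y-arc-image-swapped {v} fx with out-arc-image v (inj₂ refl)
    ... | _ , inj₁ refl , e = e
    ... | _ , inj₂ refl , e = ⊥-elim (x≢y (arc-images-distinct σ fx e))

    x-cycle-image : ∀ {v a b c d} →
      f (x ∙ v) ≡ d ∙ f v → f (x ∙ (x ∙ v)) ≡ c ∙ f (x ∙ v) →
      f (x ∙ (x ∙ (x ∙ v))) ≡ b ∙ f (x ∙ (x ∙ v)) →
      f (x ∙ (x ∙ (x ∙ (x ∙ v)))) ≡ a ∙ f (x ∙ (x ∙ (x ∙ v))) →
      a ∙ (b ∙ (c ∙ d)) ≡ ε
    x-cycle-image {v} {a} {b} {c} {d} e₁ e₂ e₃ e₄ = ∙-cancelʳ (f v) _ _ (begin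
      a ∙ (b ∙ (c ∙ d)) ∙ f v              ≡⟨ solve monoid ⟩
      a ∙ (b ∙ (c ∙ (d ∙ f v)))            ≡⟨ cong (λ z → a ∙ (b ∙ (c ∙ z))) (sym e₁) ⟩
      a ∙ (b ∙ (c ∙ f (x ∙ v)))            ≡⟨ cong (λ z → a ∙ (b ∙ z)) (sym e₂) ⟩
      a ∙ (b ∙ f (x ∙ (x ∙ v)))            ≡⟨ cong (a ∙_) (sym e₃) ⟩
      a ∙ f (x ∙ (x ∙ (x ∙ v)))            ≡⟨ sym e₄ ⟩
      f (x ∙ (x ∙ (x ∙ (x ∙ v))))          ≡⟨ cong f x⁴∙v≡v ⟩
      f v                                  ≡⟨ sym (identityˡ _) ⟩
      ε ∙ f v                              ∎)
      where
      x⁴∙v≡v : x ∙ (x ∙ (x ∙ (x ∙ v))) ≡ v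
      x⁴∙v≡v = begin
        x ∙ (x ∙ (x ∙ (x ∙ v)))   ≡⟨ solve monoid ⟩
        pow G x 4 ∙ v             ≡⟨ cong (_∙ v) x⁴≡ε ⟩
        ε ∙ v                     ≡⟨ identityˡ v ⟩
        v                         ∎

    swapped⇒commute : ∀ {v} → Swapped v → x ∙ y ≡ y ∙ x
    swapped⇒commute {v} e₁
      with out-arc-image (x ∙ v) (inj₁ refl)
         | out-arc-image (x ∙ (x ∙ v)) (inj₁ refl)
         | out-arc-image (x ∙ (x ∙ (x ∙ v))) (inj₁ refl)
    ... | c , Sc , e₂ | b , Sb , e₃ | a , Sa , e₄ =
      closed-walk⇒commute Sa Sb Sc (x-cycle-image e₁ e₂ e₃ e₄)

    -- Compare the images of the two paths w → yw → xyw and w → xw → yxw, which end at the same vertex.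
    swapped-step : x ∙ y ≡ y ∙ x → ∀ {w} → Swapped w → Swapped (x ∙ w)
    swapped-step comm {w} sw with x-arc-image (x ∙ w)
    ... | inj₂ sxw = sxw
    ... | inj₁ fxxw with out-arc-image (y ∙ w) (inj₁ refl)
    ...   | t , St , fxyw = ⊥-elim (y∙y≢s∙x St (∙-cancelʳ (f w) _ _ (begin
      y ∙ y ∙ f w           ≡⟨ assoc _ _ _ ⟩
      y ∙ (y ∙ f w)         ≡⟨ cong (y ∙_) (sym sw) ⟩
      y ∙ f (x ∙ w)         ≡⟨ sym (y-arc-image-unswapped fxxw) ⟩
      f (y ∙ (x ∙ w))       ≡⟨ cong f yxw≡xyw ⟩
      f (x ∙ (y ∙ w))       ≡⟨ fxyw ⟩
      t ∙ f (y ∙ w)         ≡⟨ cong (t ∙_) (y-arc-image-swapped sw) ⟩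
      t ∙ (x ∙ f w)         ≡⟨ sym (assoc _ _ _) ⟩
      t ∙ x ∙ f w           ∎)))
      where
      yxw≡xyw : y ∙ (x ∙ w) ≡ x ∙ (y ∙ w)
      yxw≡xyw = trans (sym (assoc _ _ _)) (trans (cong (_∙ w) (sym comm)) (assoc _ _ _))

    never-swapped : ∀ v → ¬ Swapped v
    never-swapped v sv = y⁴≢ε (begin
      pow G y 4           ≡⟨ solve monoid ⟩
      y ∙ (y ∙ (y ∙ y))   ≡⟨ x-cycle-image sv sxv sx²v sx³v ⟩
      ε                   ∎)
      where
      comm = swapped⇒commute sv
      sxv = swapped-step comm sv
      sx²v = swapped-step comm sxv
      sx³v = swapped-step comm sx²v

    f-x : ∀ v → f (x ∙ v) ≡ x ∙ f v
    f-x v with x-arc-image v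
    ... | inj₁ e = e
    ... | inj₂ sv = ⊥-elim (never-swapped v sv)

    f-y : ∀ v → f (y ∙ v) ≡ y ∙ f v
    f-y v = y-arc-image-unswapped (f-x v)

  isORR : GeneratedBy G x y → IsORR G S
  isORR gen = drr , no-inverse-pair⇒proper no-inverse-pair
    where
    drr : IsDRR G S
    drr σ aut = f ε , equivariant⇒right-translation f f-x f-y gen
      where open Automorphism σ aut

    no-inverse-pair : ∀ {s t} → S s → S t → s ∙ t ≢ ε
    no-inverse-pair (inj₁ refl) (inj₁ refl) xx≡ε = x²≢ε (trans (pow-two x) xx≡ε)
    no-inverse-pair (inj₁ refl) (inj₂ refl) xy≡ε = xy≢ε (trans (identityʳ _) xy≡ε)
    no-inverse-pair (inj₂ refl) (inj₁ refl) yx≡ε = xy≢ε (trans (identityʳ _) (x∙y≡ε⇒y∙x≡ε yx≡ε))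
    no-inverse-pair (inj₂ refl) (inj₂ refl) yy≡ε = y²≢ε (trans (pow-two y) yy≡ε)

-- The exceptional case of the paper needs no separate treatment: Cay(ℤ₁₂, {9, 1}) is an ORR too
-- (its automorphism group has order 12).
lemma2p5 : (G : FinGroup) → (x y : Fin (FinGroup.n G)) →
    GeneratedBy G x y →
    HasOrder G x 4 →
    (∃ λ k → HasOrder G y k × 5 ≤ k) →
    (∃ λ k → HasOrder G (FinGroup._∙_ G x y) k × 3 ≤ k) →
    ¬ (HasOrder G y 12 × (x ≡ pow G y 9) × IsoZ12 G) →
    IsORR G (pair G x y)
lemma2p5 G x y gen (_ , x⁴≡ε , x-minimal) (_ , (_ , _ , y-minimal) , 5≤k) (_ , (_ , _ , xy-minimal) , 3≤m) _ =
  TwoGenerators.isORR G x y x⁴≡ε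
    (x-minimal 2 z<s (from-yes (2 <? 4)))
    (y-minimal 2 z<s (<-≤-trans (from-yes (2 <? 5)) 5≤k))
    (y-minimal 4 z<s 5≤k)
    (xy-minimal 1 z<s (<-≤-trans (from-yes (1 <? 3)) 3≤m))
    (xy-minimal 2 z<s 3≤m)
    gen
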